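{- Let $A\ge2$ be an integer and let $D,T,W$ be finite sequences of numbers from the alphabet $\{1,2,\dots,A\}$, where $T$ and $W$ are nonempty, have the same length, and have different first elements ($D$ may be empty). Then $$\bigl|[D,T]-[D,W]\bigr|\ge\frac{1}{(2A)^4\langle D\rangle^2}.$$
   Context: For a finite nonempty sequence $X=(d_1,\dots,d_k)$ of natural numbers, $[X]=[d_1,\dots,d_k]$ denotes the continued fraction $\frac{1}{d_1+\frac{1}{d_2+\dots+\frac{1}{d_k}}}$; $(D,T)$ denotes concatenation of sequences, so $[D,T]$ is the continued fraction whose partial quotients are those of $D$ followed by those of $T$ (equal to $[T]$ if $D$ is empty). The continuant $\langle d_1,\dots,d_k\rangle$ is the denominator of $[d_1,\dots,d_k]$ written in lowest terms; the continuant of the empty sequence is $1$. -}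

module Defs where

open import Data.Nat using (ℕ)
open import Data.List using (List; []; _∷_)
open import Data.Integer using (+_)
open import Data.Rational using (ℚ; 0ℚ; 1/_; _+_; ≢-nonZero; ↧ₙ_; _/_)
open import Data.Rational.Properties using (_≟_)
open import Relation.Nullary using (yes; no)

fromℕ : ℕ → ℚ
fromℕ n = + n / 1

-- Total reciprocal on ℚ: 1/q for q ≠ 0, and 0 at q = 0 (only used where q > 0).
inv : ℚ → ℚ
inv q with q ≟ 0ℚ
... | yes _ = 0ℚ
... | no q≢0 = 1/_ q {{≢-nonZero q≢0}}

-- [d₁,…,dₖ] = 1/(d₁ + 1/(d₂ + … + 1/dₖ)); the empty sequence gives 0
-- (so that [D,T] with D empty is [T], and the lowest-terms denominator of [] is 1).
cf : List ℕ → ℚ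
cf []       = 0ℚ
cf (d ∷ ds) = inv (fromℕ d + cf ds)

-- Continuant ⟨X⟩: denominator of [X] in lowest terms (ℚ is always normalised); ⟨⟩ = 1.
continuant : List ℕ → ℕ
continuant X = ↧ₙ (cf X)

-- Continuants are computed by folding the step x ↦ 1/(d + x) over pairs
-- (numerator , denominator), so that [X] = num X / den X.  Prepending a common quotient has
--     determinant −1 and preserves K; comparing the first quotients of the tails
--     t∷T', w∷W' yields such a K with den T'·den W' ≤ (A+1)K.
-- (4) Size: den(D,T)·den(D,W) ≤ 4(A+1)³⟨D⟩²K ≤ (2A)⁴⟨D⟩²K, which turns the exact
--     distance K/(den(D,T)·den(D,W)) into the claimed lower bound.
module Submission where

open import Defs
open import Data.Nat as ℕ using (ℕ; suc; _+_; _*_; _^_; _∸_; _≤_; _<_; z≤n; s≤s; NonZero; >-nonZero)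
import Data.Nat.Properties as ℕP
open import Data.Nat.Tactic.RingSolver using (solve-∀)
open import Data.Nat.Divisibility using (∣1⇒≡1; ∣m+n∣m⇒∣n; ∣-trans; n∣m*n)
open import Data.Nat.Coprimality using (Coprime)
open import Data.List using (List; []; _∷_; _++_; length; foldr)
open import Data.List.Properties using (foldr-++)
open import Data.List.Relation.Unary.All as All using (All; []; _∷_)
open import Data.List.Relation.Unary.All.Properties using (++⁺)
open import Data.Product using (_×_; _,_; proj₁; proj₂; ∃-syntax)
open import Data.Sum using (_⊎_; inj₁; inj₂; swap)
open import Data.Integer as ℤ using (+_; _⊖_)
import Data.Integer.Properties as ℤP
open import Data.Rational as ℚ using (0ℚ; ∣_∣; _-_; _≥_; toℚᵘ; fromℚᵘ; ≢-nonZero)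
import Data.Rational.Properties as ℚP
open import Data.Rational.Unnormalised as ℚᵘ using (mkℚᵘ; _≃_; *≡*; *≤*; _/_)
import Data.Rational.Unnormalised.Properties as ℚᵘP
open import Data.Empty using (⊥-elim)
open import Relation.Binary.PropositionalEquality
open import Relation.Binary.Definitions using (tri<; tri≈; tri>)
open import Relation.Nullary using (yes; no)

-- A pair (p , q) stands for the fraction p/q.  Prepending the partial quotient d
-- sends x = p/q to 1/(d + x) = q/(dq + p).
prefix : ℕ → ℕ × ℕ → ℕ × ℕ
prefix d (p , q) = q , d * q + p

-- expand D (p , q) is the (unreduced) fraction [D, x] for x = p/q.
expand : List ℕ → ℕ × ℕ → ℕ × ℕ
expand D x = foldr prefix x D

num den : List ℕ → ℕ
num X = proj₁ (expand X (0 , 1))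
den X = proj₂ (expand X (0 , 1))

-- The continuant of D with its last partial quotient deleted: the denominator
-- of [D, x] for x = 1/0.
den⁻ : List ℕ → ℕ
den⁻ D = proj₂ (expand D (1 , 0))

combine : ℕ → ℕ → ℕ × ℕ → ℕ × ℕ → ℕ × ℕ
combine a b (u₁ , u₂) (v₁ , v₂) = a * u₁ + b * v₁ , a * u₂ + b * v₂

prefix-linear : ∀ d a b u v → prefix d (combine a b u v) ≡ combine a b (prefix d u) (prefix d v)
prefix-linear d a b (u₁ , u₂) (v₁ , v₂) = cong (a * u₂ + b * v₂ ,_) (distrib d a b u₁ u₂ v₁ v₂)
  where
  distrib : ∀ d a b u₁ u₂ v₁ v₂ →
    d * (a * u₂ + b * v₂) + (a * u₁ + b * v₁) ≡ a * (d * u₂ + u₁) + b * (d * v₂ + v₁)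
  distrib = solve-∀

expand-linear : ∀ D p q → expand D (p , q) ≡ combine p q (expand D (1 , 0)) (expand D (0 , 1))
expand-linear []      p q = cong₂ _,_ (unit₁ p q) (unit₂ p q)
  where
  unit₁ : ∀ p q → p ≡ p * 1 + q * 0
  unit₁ = solve-∀
  unit₂ : ∀ p q → q ≡ p * 0 + q * 1
  unit₂ = solve-∀
expand-linear (d ∷ D) p q =
  trans (cong (prefix d) (expand-linear D p q)) (prefix-linear d p q _ _)

den-++ : ∀ D L → den (D ++ L) ≡ num L * den⁻ D + den L * den D
den-++ D L = cong proj₂ (trans (foldr-++ prefix (0 , 1) D L) (expand-linear D (num L) (den L)))

Positive : List ℕ → Set
Positive = All (1 ≤_)

Digit : ℕ → ℕ → Set
Digit A d = 1 ≤ d × d ≤ A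

positive : ∀ {A X} → All (Digit A) X → Positive X
positive = All.map proj₁

den⁻≤den : ∀ {D} → Positive D → den⁻ D ≤ den D
den⁻≤den []                    = z≤n
den⁻≤den {d ∷ []} (1≤d ∷ [])   = subst₂ _≤_ (lhs d) (rhs d) 1≤d
  where
  lhs : ∀ d → 1 ≡ d * 0 + 1
  lhs = solve-∀
  rhs : ∀ d → d ≡ d * 1 + 0
  rhs = solve-∀
den⁻≤den {d ∷ _ ∷ _} (_ ∷ pos@(_ ∷ pos′)) =
  ℕP.+-mono-≤ (ℕP.*-monoʳ-≤ d (den⁻≤den pos)) (den⁻≤den pos′)

den≤den-cons : ∀ {d} X → 1 ≤ d → den X ≤ den (d ∷ X)
den≤den-cons {d} X 1≤d =
  ℕP.≤-trans (ℕP.m≤n*m (den X) d {{>-nonZero 1≤d}}) (ℕP.m≤m+n (d * den X) (num X))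

num≤den : ∀ {X} → Positive X → num X ≤ den X
num≤den []                 = z≤n
num≤den {_ ∷ X} (1≤d ∷ _) = den≤den-cons X 1≤d

den-positive : ∀ {X} → Positive X → 1 ≤ den X
den-positive []                   = s≤s z≤n
den-positive {_ ∷ X} (1≤d ∷ pos) = ℕP.≤-trans (den-positive pos) (den≤den-cons X 1≤d)

den-nonZero : ∀ {X} → Positive X → NonZero (den X)
den-nonZero pos = >-nonZero (den-positive pos)

den-cons≤ : ∀ {A d} X → d ≤ A → num X ≤ den X → den (d ∷ X) ≤ suc A * den X
den-cons≤ {A} X d≤A num≤ = ℕP.≤-trans
  (ℕP.+-mono-≤ (ℕP.*-monoˡ-≤ (den X) d≤A) num≤)
  (ℕP.≤-reflexive (ℕP.+-comm (A * den X) (den X)))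

den-++≤ : ∀ {D L} → Positive D → Positive L → den (D ++ L) ≤ 2 * den D * den L
den-++≤ {D} {L} posD posL = begin
  den (D ++ L)                         ≡⟨ den-++ D L ⟩
  num L * den⁻ D + den L * den D       ≤⟨ ℕP.+-monoˡ-≤ (den L * den D) (ℕP.*-mono-≤ (num≤den posL) (den⁻≤den posD)) ⟩
  den L * den D + den L * den D        ≡⟨ double (den D) (den L) ⟩
  2 * den D * den L                    ∎
  where
  open ℕP.≤-Reasoning
  double : ∀ a b → b * a + b * a ≡ 2 * a * b
  double = solve-∀

-- Consecutive continuants are coprime, so num X / den X is in lowest terms.
num-den-coprime : ∀ X → Coprime (num X) (den X)
num-den-coprime []      (_ , i∣1)     = ∣1⇒≡1 i∣1
num-den-coprime (d ∷ X) (i∣p , i∣q) =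
  num-den-coprime X (∣m+n∣m⇒∣n i∣q (∣-trans i∣p (n∣m*n d)) , i∣p)

fromℕ-value : ∀ n → toℚᵘ (fromℕ n) ≃ + n / 1
fromℕ-value n = ℚP.toℚᵘ-fromℚᵘ (+ n / 1)

integer-+ : ∀ d p q .{{_ : NonZero q}} → (+ d / 1) ℚᵘ.+ (+ p / q) ≃ + (d * q + p) / q
integer-+ d p (suc q) = *≡* (cong₂ ℤ._*_ numerator (cong +_ (sym (ℕP.*-identityˡ (suc q)))))
  where
  open ≡-Reasoning
  numerator : + d ℤ.* + suc q ℤ.+ + p ℤ.* + 1 ≡ + (d * suc q + p)
  numerator = begin
    + d ℤ.* + suc q ℤ.+ + p ℤ.* + 1  ≡⟨ cong₂ ℤ._+_ (sym (ℤP.pos-* d (suc q))) (ℤP.*-identityʳ (+ p)) ⟩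
    + (d * suc q) ℤ.+ + p             ≡⟨ sym (ℤP.pos-+ (d * suc q) p) ⟩
    + (d * suc q + p)                 ∎

1/-fraction : ∀ {r} m n .{{_ : ℚᵘ.NonZero r}} .{{_ : NonZero m}} .{{_ : NonZero n}} →
  r ≃ + m / n → ℚᵘ.1/ r ≃ + n / m
1/-fraction {mkℚᵘ ℤ.+[1+ k ] e} (suc m) (suc n) (*≡* eq) =
  *≡* (trans (ℤP.*-comm ℤ.+[1+ e ] (+ suc m)) (trans (sym eq) (ℤP.*-comm ℤ.+[1+ k ] (+ suc n))))
1/-fraction {mkℚᵘ ℤ.-[1+ k ] e} (suc m) (suc n) (*≡* ())

inv-fraction : ∀ {y} m n .{{_ : NonZero m}} .{{_ : NonZero n}} →
  toℚᵘ y ≃ + m / n → toℚᵘ (inv y) ≃ + n / m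
inv-fraction {y} (suc m) (suc n) y≃ with y ℚP.≟ 0ℚ
... | yes refl with y≃
...   | *≡* ()
inv-fraction {y} (suc m) (suc n) y≃ | no y≢0 =
  ℚᵘP.≃-trans (ℚP.toℚᵘ-homo-1/ y {{≢-nonZero y≢0}}) (1/-fraction (suc m) (suc n) {{≢-nonZero y≢0}} y≃)

cf-value : ∀ {X} (pos : Positive X) → toℚᵘ (cf X) ≃ (+ num X / den X) {{den-nonZero pos}}
cf-value []                 = ℚᵘP.≃-refl
cf-value {d ∷ X} (1≤d ∷ pos) =
  inv-fraction (den (d ∷ X)) (den X) {{den-nonZero (1≤d ∷ pos)}} {{den-nonZero pos}} sum
  where
  instance
    den≢0 : NonZero (den X)
    den≢0 = den-nonZero pos
  sum : toℚᵘ (fromℕ d ℚ.+ cf X) ≃ + (d * den X + num X) / den X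
  sum = ℚᵘP.≃-trans (ℚP.toℚᵘ-homo-+ (fromℕ d) (cf X))
          (ℚᵘP.≃-trans (ℚᵘP.+-cong (fromℕ-value d) (cf-value pos)) (integer-+ d (num X) (den X)))

reduced-denominator : ∀ n d .{{_ : NonZero d}} → Coprime n d → ℚ.↧ₙ (fromℚᵘ (+ n / d)) ≡ d
reduced-denominator n (suc d) n⊥d = cong ℚ.↧ₙ_ (ℚP.normalize-coprime n⊥d)

continuant≡den : ∀ {X} → Positive X → continuant X ≡ den X
continuant≡den {X} pos = begin
  ℚ.↧ₙ (cf X)                                        ≡⟨ cong ℚ.↧ₙ_ (sym (ℚP.fromℚᵘ-toℚᵘ (cf X))) ⟩
  ℚ.↧ₙ (fromℚᵘ (toℚᵘ (cf X)))                        ≡⟨ cong ℚ.↧ₙ_ (ℚP.fromℚᵘ-cong (cf-value pos)) ⟩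
  ℚ.↧ₙ (fromℚᵘ ((+ num X / den X) {{den-nonZero pos}})) ≡⟨ reduced-denominator (num X) (den X) {{den-nonZero pos}} (num-den-coprime X) ⟩
  den X                                              ∎
  where open ≡-Reasoning

Apart : ℕ → ℕ → ℕ → Set
Apart K x y = x ≡ y + K ⊎ y ≡ x + K

-- Adding P to both numbers preserves their difference (stated with the two
-- numbers swapped, as prepending a quotient swaps the cross products).
Apart-shift : ∀ {K x y} P → Apart K x y → Apart K (P + y) (P + x)
Apart-shift {K} {x} {y} P (inj₁ x≡y+K) = inj₂ (trans (cong (λ z → P + z) x≡y+K) (sym (ℕP.+-assoc P y K)))
Apart-shift {K} {x} {y} P (inj₂ y≡x+K) = inj₁ (trans (cong (λ z → P + z) y≡x+K) (sym (ℕP.+-assoc P x K)))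

Apart-distance : ∀ {K x y} → Apart K x y → ℤ.∣ x ⊖ y ∣ ≡ K
Apart-distance {K} {x} {y} (inj₁ refl) =
  trans (ℤP.∣m⊖n∣≡∣n⊖m∣ (y + K) y) (trans (ℤP.∣⊖∣-≤ (ℕP.m≤m+n y K)) (ℕP.m+n∸m≡n y K))
Apart-distance {K} {x} {y} (inj₂ refl) = trans (ℤP.∣⊖∣-≤ (ℕP.m≤m+n x K)) (ℕP.m+n∸m≡n x K)

-- [X] and [Y] are separated by K when |num X·den Y − num Y·den X| = K,
-- i.e. |[X] − [Y]| = K / (den X · den Y).
Separated : ℕ → List ℕ → List ℕ → Set
Separated K X Y = Apart K (num X * den Y) (num Y * den X)

-- Prepending a common partial quotient preserves separation: the determinant
-- of x ↦ 1/(d + x) is −1.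
separated-cons : ∀ d {K X Y} → Separated K X Y → Separated K (d ∷ X) (d ∷ Y)
separated-cons d {K} {X} {Y} sep =
  subst₂ (Apart K) (left d (den X) (den Y) (num Y)) (right d (den X) (den Y) (num X))
    (Apart-shift (d * (den X * den Y)) sep)
  where
  left : ∀ d a b c → d * (a * b) + c * a ≡ a * (d * b + c)
  left = solve-∀
  right : ∀ d a b c → d * (a * b) + c * b ≡ b * (d * a + c)
  right = solve-∀

separated-prefix : ∀ D {K X Y} → Separated K X Y → Separated K (D ++ X) (D ++ Y)
separated-prefix []      sep = sep
separated-prefix (d ∷ D) {K} {X} {Y} sep =
  separated-cons d {K} {D ++ X} {D ++ Y} (separated-prefix D {K} {X} {Y} sep)

fraction-distance : ∀ {K} a b c e .{{_ : NonZero b}} .{{_ : NonZero e}} → Apart K (a * e) (c * b) →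
  ℚᵘ.∣ + a / b ℚᵘ.- + c / e ∣ ≃ (+ K / (b * e)) {{ℕP.m*n≢0 b e}}
fraction-distance {K} a (suc b) c (suc e) apart = ℚᵘP.≃-reflexive (cong (λ n → mkℚᵘ (+ n) _) distance)
  where
  distance : ℤ.∣ + a ℤ.* + suc e ℤ.+ ℤ.- (+ c) ℤ.* + suc b ∣ ≡ K
  distance = begin
    ℤ.∣ + a ℤ.* + suc e ℤ.+ ℤ.- (+ c) ℤ.* + suc b ∣
      ≡⟨ cong ℤ.∣_∣ (cong₂ ℤ._+_ (sym (ℤP.pos-* a (suc e)))
           (trans (sym (ℤP.neg-distribˡ-* (+ c) (+ suc b))) (cong ℤ.-_ (sym (ℤP.pos-* c (suc b)))))) ⟩
    ℤ.∣ + (a * suc e) ℤ.+ ℤ.- + (c * suc b) ∣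
      ≡⟨ cong ℤ.∣_∣ (ℤP.m-n≡m⊖n (a * suc e) (c * suc b)) ⟩
    ℤ.∣ (a * suc e) ⊖ (c * suc b) ∣
      ≡⟨ Apart-distance apart ⟩
    K ∎
    where open ≡-Reasoning

fraction-≤ : ∀ K M N .{{_ : NonZero M}} .{{_ : NonZero N}} → M ≤ K * N → + 1 / N ℚᵘ.≤ + K / M
fraction-≤ K (suc M) (suc N) M≤KN = *≤* (subst₂ ℤ._≤_ (ℤP.pos-* 1 (suc M)) (ℤP.pos-* K (suc N))
  (ℤ.+≤+ (subst (_≤ K * suc N) (sym (ℕP.*-identityˡ (suc M))) M≤KN)))

separated-distance : ∀ {K X Y} N .{{_ : NonZero N}} → Positive X → Positive Y →
  Separated K X Y → den X * den Y ≤ K * N → ∣ cf X - cf Y ∣ ≥ inv (fromℕ N)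
separated-distance {K} {X} {Y} N posX posY sep le = ℚP.toℚᵘ-cancel-≤ (begin
  toℚᵘ (inv (fromℕ N))                            ≃⟨ inv-fraction N 1 (fromℕ-value N) ⟩
  + 1 / N                                          ≤⟨ fraction-≤ K (den X * den Y) N le ⟩
  + K / (den X * den Y)                            ≃⟨ fraction-distance (num X) (den X) (num Y) (den Y) sep ⟨
  ℚᵘ.∣ + num X / den X ℚᵘ.- + num Y / den Y ∣      ≃⟨ ℚᵘP.∣-∣-cong (ℚᵘP.+-cong (cf-value posX) (ℚᵘP.-‿cong (cf-value posY))) ⟨
  ℚᵘ.∣ toℚᵘ (cf X) ℚᵘ.- toℚᵘ (cf Y) ∣              ≃⟨ toℚᵘ-∣-∣ ⟨
  toℚᵘ ∣ cf X - cf Y ∣                             ∎)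
  where
  open ℚᵘP.≤-Reasoning
  instance
    denX≢0 : NonZero (den X)
    denX≢0 = den-nonZero posX
    denY≢0 : NonZero (den Y)
    denY≢0 = den-nonZero posY
    denXY≢0 : NonZero (den X * den Y)
    denXY≢0 = ℕP.m*n≢0 (den X) (den Y)
  toℚᵘ-∣-∣ : toℚᵘ ∣ cf X - cf Y ∣ ≃ ℚᵘ.∣ toℚᵘ (cf X) ℚᵘ.- toℚᵘ (cf Y) ∣
  toℚᵘ-∣-∣ = ℚᵘP.≃-trans (ℚP.toℚᵘ-homo-∣-∣ (cf X - cf Y)) (ℚᵘP.∣-∣-cong
    (ℚᵘP.≃-trans (ℚP.toℚᵘ-homo-+ (cf X) (ℚ.- cf Y)) (ℚᵘP.+-congʳ (toℚᵘ (cf X)) (ℚP.toℚᵘ-homo‿- (cf Y)))))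

-- Arithmetic core of comparing [t, T'] with [w, W'] for t < w, where
-- T' = P₁/Q₁ and W' = P₂/Q₂: the cross products differ by
-- K = (Q₁ − P₁)Q₂ + Q₁P₂ + (w − t − 1)Q₁Q₂.
first-quotient-gap : ∀ {t w P₁ Q₁} P₂ Q₂ → t < w → P₁ ≤ Q₁ →
  ∃[ K ] Q₁ * (w * Q₂ + P₂) ≡ Q₂ * (t * Q₁ + P₁) + K × (Q₁ ∸ P₁) * Q₂ + Q₁ * P₂ ≤ K
first-quotient-gap {t} {w} {P₁} {Q₁} P₂ Q₂ t<w P₁≤Q₁
  with ℕP.m≤n⇒∃[o]m+o≡n t<w | ℕP.m≤n⇒∃[o]m+o≡n P₁≤Q₁
... | k , refl | r , refl =
  r * Q₂ + (P₁ + r) * P₂ + k * (P₁ + r) * Q₂ ,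
  expand-gap t k P₁ r P₂ Q₂ ,
  subst (λ n → n * Q₂ + (P₁ + r) * P₂ ≤ r * Q₂ + (P₁ + r) * P₂ + k * (P₁ + r) * Q₂)
    (sym (ℕP.m+n∸m≡n P₁ r)) (ℕP.m≤m+n (r * Q₂ + (P₁ + r) * P₂) (k * (P₁ + r) * Q₂))
  where
  expand-gap : ∀ t k P₁ r P₂ Q₂ → (P₁ + r) * ((suc t + k) * Q₂ + P₂)
    ≡ Q₂ * (t * (P₁ + r) + P₁) + (r * Q₂ + (P₁ + r) * P₂ + k * (P₁ + r) * Q₂)
  expand-gap = solve-∀

tail-bound : ∀ {A} T' W' → All (Digit A) T' → All (Digit A) W' → length T' ≡ length W' →
  den T' * den W' ≤ suc A * ((den T' ∸ num T') * den W' + den T' * num W')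
tail-bound []      []      _ _         _  = s≤s z≤n
tail-bound (_ ∷ _) []      _ _         ()
tail-bound {A} T' (v ∷ V) _ ((_ , v≤A) ∷ hV) _ = begin
  den T' * den (v ∷ V)                                    ≤⟨ ℕP.*-monoʳ-≤ (den T') (den-cons≤ V v≤A (num≤den (positive hV))) ⟩
  den T' * (suc A * den V)                                ≡⟨ exchange (den T') (suc A) (den V) ⟩
  suc A * (den T' * num (v ∷ V))                          ≤⟨ ℕP.*-monoʳ-≤ (suc A) (ℕP.m≤n+m _ _) ⟩
  suc A * ((den T' ∸ num T') * den (v ∷ V) + den T' * num (v ∷ V)) ∎
  where
  open ℕP.≤-Reasoning
  exchange : ∀ a b c → a * (b * c) ≡ b * (a * c)
  exchange = solve-∀

ordered-tails-separated : ∀ {A t w} T' W' → All (Digit A) T' → All (Digit A) W' →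
  length T' ≡ length W' → t < w →
  ∃[ K ] Separated K (t ∷ T') (w ∷ W') × den T' * den W' ≤ suc A * K
ordered-tails-separated {A} T' W' hT hW len t<w
  with first-quotient-gap (num W') (den W') t<w (num≤den (positive hT))
... | K , gap , K≥ = K , inj₁ gap , ℕP.≤-trans (tail-bound T' W' hT hW len) (ℕP.*-monoʳ-≤ (suc A) K≥)

tails-separated : ∀ {A t w} T' W' → All (Digit A) (t ∷ T') → All (Digit A) (w ∷ W') →
  length T' ≡ length W' → t ≢ w →
  ∃[ K ] Separated K (t ∷ T') (w ∷ W') × den T' * den W' ≤ suc A * K
tails-separated {A} {t} {w} T' W' (_ ∷ hT) (_ ∷ hW) len t≢w with ℕP.<-cmp t w
... | tri< t<w _ _ = ordered-tails-separated T' W' hT hW len t<w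
... | tri≈ _ t≡w _ = ⊥-elim (t≢w t≡w)
... | tri> _ _ w<t with ordered-tails-separated W' T' hW hT (sym len) w<t
...   | K , sep , bound = K , swap sep , subst (_≤ suc A * K) (ℕP.*-comm (den W') (den T')) bound

den-prefix-cons≤ : ∀ {A D d X} → Positive D → All (Digit A) (d ∷ X) →
  den (D ++ d ∷ X) ≤ 2 * den D * (suc A * den X)
den-prefix-cons≤ {A} {D} {d} {X} posD hdX@((_ , d≤A) ∷ hX) = ℕP.≤-trans
  (den-++≤ posD (positive hdX))
  (ℕP.*-monoʳ-≤ (2 * den D) (den-cons≤ X d≤A (num≤den (positive hX))))

constant-bound : ∀ A → 2 ≤ A → 4 * suc A ^ 3 ≤ (2 * A) ^ 4
constant-bound A 2≤A = ℕP.*-mono-≤ (ℕP.*-monoʳ-≤ 2 2≤A) (ℕP.^-monoˡ-≤ 3 1+A≤2A)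
  where
  1+A≤2A : 1 + A ≤ A + (A + 0)
  1+A≤2A = ℕP.+-mono-≤ (ℕP.≤-trans (s≤s z≤n) 2≤A) (ℕP.≤-reflexive (sym (ℕP.+-identityʳ A)))

product-bound : ∀ A c Q₁ Q₂ K x y → 2 ≤ A → x ≤ 2 * c * (suc A * Q₁) → y ≤ 2 * c * (suc A * Q₂) →
  Q₁ * Q₂ ≤ suc A * K → x * y ≤ K * ((2 * A) ^ 4 * c ^ 2)
product-bound A c Q₁ Q₂ K x y 2≤A x≤ y≤ Q₁Q₂≤ = begin
  x * y                                       ≤⟨ ℕP.*-mono-≤ x≤ y≤ ⟩
  2 * c * (suc A * Q₁) * (2 * c * (suc A * Q₂)) ≡⟨ regroup₁ c (suc A) Q₁ Q₂ ⟩
  4 * c ^ 2 * suc A ^ 2 * (Q₁ * Q₂)             ≤⟨ ℕP.*-monoʳ-≤ (4 * c ^ 2 * suc A ^ 2) Q₁Q₂≤ ⟩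
  4 * c ^ 2 * suc A ^ 2 * (suc A * K)          ≡⟨ regroup₂ c (suc A) K ⟩
  K * (4 * suc A ^ 3 * c ^ 2)                  ≤⟨ ℕP.*-monoʳ-≤ K (ℕP.*-monoˡ-≤ (c ^ 2) (constant-bound A 2≤A)) ⟩
  K * ((2 * A) ^ 4 * c ^ 2)                    ∎
  where
  open ℕP.≤-Reasoning
  -- (stated with c ^ 2 unfolded to c * (c * 1), which the solver handles)
  regroup₁ : ∀ c a Q₁ Q₂ → 2 * c * (a * Q₁) * (2 * c * (a * Q₂)) ≡ 4 * (c * (c * 1)) * (a * (a * 1)) * (Q₁ * Q₂)
  regroup₁ = solve-∀
  regroup₂ : ∀ c a K → 4 * (c * (c * 1)) * (a * (a * 1)) * (a * K) ≡ K * (4 * (a * (a * (a * 1))) * (c * (c * 1)))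
  regroup₂ = solve-∀

denominators-bound : ∀ {A K D t T' w W'} → 2 ≤ A → All (Digit A) D →
  All (Digit A) (t ∷ T') → All (Digit A) (w ∷ W') → den T' * den W' ≤ suc A * K →
  den (D ++ t ∷ T') * den (D ++ w ∷ W') ≤ K * ((2 * A) ^ 4 * continuant D ^ 2)
denominators-bound {A} {K} {D} {t} {T'} {w} {W'} 2≤A hD hT hW tails-bound =
  subst (λ c → den (D ++ t ∷ T') * den (D ++ w ∷ W') ≤ K * ((2 * A) ^ 4 * c ^ 2))
    (sym (continuant≡den (positive hD)))
    (product-bound A (den D) (den T') (den W') K _ _ 2≤A
      (den-prefix-cons≤ (positive hD) hT) (den-prefix-cons≤ (positive hD) hW) tails-bound)

lemma5p1 : (A : ℕ) → 2 ≤ A →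
    (D : List ℕ) (t : ℕ) (T' : List ℕ) (w : ℕ) (W' : List ℕ) →
    All (λ d → 1 ≤ d × d ≤ A) D →
    All (λ d → 1 ≤ d × d ≤ A) (t ∷ T') →
    All (λ d → 1 ≤ d × d ≤ A) (w ∷ W') →
    length T' ≡ length W' →
    t ≢ w →
    ∣ cf (D ++ (t ∷ T')) - cf (D ++ (w ∷ W')) ∣
      ≥ inv (fromℕ ((2 * A) ^ 4 * continuant D ^ 2))
lemma5p1 A 2≤A D t T' w W' hD hT hW len t≢w
  with tails-separated T' W' hT hW len t≢w
... | K , tails-sep , tails-bound =
  separated-distance N (positive (++⁺ hD hT)) (positive (++⁺ hD hW))
    (separated-prefix D {K} {t ∷ T'} {w ∷ W'} tails-sep)
    (denominators-bound 2≤A hD hT hW tails-bound)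
  where
  N : ℕ
  N = (2 * A) ^ 4 * continuant D ^ 2
  instance
    N≢0 : NonZero N
    N≢0 = ℕP.m*n≢0 ((2 * A) ^ 4) (continuant D ^ 2) {{ℕP.m^n≢0 (2 * A) 4 {{2A≢0}}}}
      where
      2A≢0 : NonZero (2 * A)
      2A≢0 = >-nonZero (ℕP.≤-trans (s≤s z≤n) (ℕP.*-monoʳ-≤ 2 2≤A))
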